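{- Let $N\ge 3$ and $k,\ell\ge 0$ be integers. For the game $CSG(I_N)$: if $|S_{1,k,\ell}|\equiv 0 \pmod{N+1}$ then $\mathcal{G}_{I_N}(S_{1,k,\ell})=0$; if $|S_{1,k,\ell}|\equiv 1\pmod{N+1}$ then $\mathcal{G}_{I_N}(S_{1,k,\ell})=1$; otherwise $\mathcal{G}_{I_N}(S_{1,k,\ell})>1$.
   Context: $I_N=\{1,\ldots,N\}$. For a set $L$ of positive integers, the game $CSG(L)$ on a connected graph $G$ is the two-player impartial game in which a move consists in removing from the current graph a connected subgraph $H$ such that $|V(H)|\in L$ and the remaining graph is connected (the empty graph counts as connected, so removing the whole graph is allowed when its size is in $L$). The player unable to move loses. $\mathcal{G}_L(G)$ is the Grundy value of $CSG(L)$ on $G$. The subdivided star $S_{1,k,\ell}$ is obtained from a central vertex by attaching three disjoint paths with $1$, $k$ and $\ell$ vertices; $|S_{1,k,\ell}|=k+\ell+2$ is its number of vertices. -}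

module Defs where

open import Data.Bool using (Bool; true; false; _∧_; _∨_; not; if_then_else_)
open import Data.Nat using (ℕ; zero; suc; _+_; _≡ᵇ_; _≤ᵇ_)
open import Data.Fin using (Fin; toℕ) renaming (zero to fz; suc to fs)
open import Data.Fin.Subset using (Subset; ⊤; ⁅_⁆; ∁; _∩_; ∣_∣)
open import Data.Vec using (Vec; []; _∷_; lookup; tabulate)
open import Data.List using (List; []; _∷_; [_]; _++_; map; filterᵇ; length)
open import Data.Bool.ListAction using (any)
open import Function using (_∘_)

-- Finite simple graphs on vertex set Fin n, given by a (symmetric)
-- Boolean adjacency function.  A vertex set is a Subset n (Vec Bool n);
-- the graph "G[S]" is the subgraph induced by S.

Graph : ℕ → Set
Graph n = Fin n → Fin n → Bool

anyF : ∀ {n} → (Fin n → Bool) → Bool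
anyF {zero}  f = false
anyF {suc n} f = f fz ∨ anyF (f ∘ fs)

allF : ∀ {n} → (Fin n → Bool) → Bool
allF {zero}  f = true
allF {suc n} f = f fz ∧ allF (f ∘ fs)

iterate : ∀ {A : Set} → (A → A) → ℕ → A → A
iterate f zero    x = x
iterate f (suc m) x = f (iterate f m x)

step : ∀ {n} → Graph n → Subset n → Subset n → Subset n
step G S R = tabulate λ u →
  lookup R u ∨ (lookup S u ∧ anyF (λ w → lookup R w ∧ G w u))

-- vertices reachable from v by a path inside S (paths of length < n
-- suffice, hence n iterations)
reach : ∀ {n} → Graph n → Subset n → Fin n → Subset n
reach {n} G S v = iterate (step G S) n ⁅ v ⁆

-- G[S] is connected: any two vertices of S are joined by a path in G[S].
-- (The empty graph counts as connected.)
connected : ∀ {n} → Graph n → Subset n → Bool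
connected G S = allF λ u → allF λ v →
  not (lookup S u ∧ lookup S v) ∨ lookup (reach G S u) v

allSubsets : ∀ n → List (Subset n)
allSubsets zero    = [ [] ]
allSubsets (suc n) = map (true ∷_) (allSubsets n) ++ map (false ∷_) (allSubsets n)

_⊆ᵇ_ : ∀ {n} → Subset n → Subset n → Bool
T ⊆ᵇ P = allF λ i → not (lookup T i) ∨ lookup P i

-- L is a set of positive integers given by its
-- characteristic function.  A position is the vertex set P of the current
-- (induced) graph G[P].

legalMove : ∀ {n} → Graph n → (ℕ → Bool) → Subset n → Subset n → Bool
legalMove G L P T =
  (T ⊆ᵇ P) ∧ (1 ≤ᵇ ∣ T ∣) ∧ L ∣ T ∣ ∧ connected G T ∧ connected G (P ∩ ∁ T)

options : ∀ {n} → Graph n → (ℕ → Bool) → Subset n → List (Subset n)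
options {n} G L P = map (λ T → P ∩ ∁ T) (filterᵇ (legalMove G L P) (allSubsets n))

elemᵇ : ℕ → List ℕ → Bool
elemᵇ m = any (m ≡ᵇ_)

mexFrom : ℕ → ℕ → List ℕ → ℕ
mexFrom zero     m xs = m
mexFrom (suc f)  m xs = if elemᵇ m xs then mexFrom f (suc m) xs else m

mex : List ℕ → ℕ
mex xs = mexFrom (suc (length xs)) 0 xs

-- Grundy value with fuel; every move removes at least one vertex, so fuel n
-- (the number of vertices) is enough to evaluate the full game tree.
grundyF : ∀ {n} → Graph n → (ℕ → Bool) → ℕ → Subset n → ℕ
grundyF G L zero    P = 0
grundyF G L (suc f) P = mex (map (grundyF G L f) (options G L P))

grundy : ∀ {n} → (ℕ → Bool) → Graph n → ℕ
grundy {n} L G = grundyF G L n ⊤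

I : ℕ → (ℕ → Bool)
I N m = (1 ≤ᵇ m) ∧ (m ≤ᵇ N)

-- Subdivided star S_{1,k,ℓ} on vertices 0 .. k+ℓ+1:
--   0 = centre, 1 = the single pendant vertex,
--   2 .. k+1 = the path with k vertices (2 adjacent to the centre),
--   k+2 .. k+ℓ+1 = the path with ℓ vertices (k+2 adjacent to the centre).

starEdge : ℕ → ℕ → ℕ → ℕ → Bool
starEdge k ℓ a b =
     ((a ≡ᵇ 0) ∧ (b ≡ᵇ 1))
  ∨ ((a ≡ᵇ 0) ∧ (b ≡ᵇ 2) ∧ (1 ≤ᵇ k))
  ∨ ((2 ≤ᵇ a) ∧ (a ≤ᵇ k) ∧ (b ≡ᵇ suc a))
  ∨ ((a ≡ᵇ 0) ∧ (b ≡ᵇ k + 2) ∧ (1 ≤ᵇ ℓ))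
  ∨ ((k + 2 ≤ᵇ a) ∧ (a ≤ᵇ k + ℓ) ∧ (b ≡ᵇ suc a))

S1 : (k ℓ : ℕ) → Graph (k + ℓ + 2)
S1 k ℓ u v = starEdge k ℓ (toℕ u) (toℕ v) ∨ starEdge k ℓ (toℕ v) (toℕ u)

-- The Grundy value of a position only matters through its class `cap` in {0, 1, ≥ 2}, and by
-- induction on positions, for every connected vertex set P of S_{1,k,ℓ},
--   cap (𝒢(P)) = cap (|P| mod (N+1)).
-- A move removes between 1 and N vertices, so it always changes |P| mod (N+1): from residue 0
-- or 1 no option has the same residue. Conversely, with r = |P| mod (N+1), the moves removing
-- r and r - 1 vertices reach residues 0 and 1. Such moves exist because a set is connected iff
-- it is an interval of the spine (the path through the centre and the two long legs), plus the
-- pendant vertex only if it also contains the centre (or is just the pendant). Cutting P after a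
-- prefix of the spine, or before a suffix, gives two connected parts; the prefix sizes grow by at
-- most 2 per step, and by 2 only at the centre when the pendant lies in P. So every size j ≤ |P|
-- is cut off by a prefix or a suffix unless both jump over it at the centre, which forces
-- |P| = 2j; then j = 1 and the pendant itself is the move.

module Submission where

open import Data.Bool using (Bool; true; false; T; T?; _∧_; _∨_; not)
open import Data.Bool.Properties using (T-∧; T-∨; T-≡; ∨-comm; ∧-assoc; ∧-identityʳ; ∧-zeroʳ; not-involutive)
open import Data.Empty using (⊥-elim)
open import Data.Fin using (Fin; toℕ; fromℕ<) renaming (zero to fz; suc to fs)
open import Data.Fin.Properties using (toℕ-fromℕ<; toℕ-injective; toℕ<n)
import Data.Fin.Properties as Finₚ
open import Data.Fin.Subset using (Subset; ⊤; ⁅_⁆; ∁; _∩_; ∣_∣)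
open import Data.Fin.Subset.Properties using (x∈⁅x⁆; x∈⁅y⁆⇒x≡y; ∣⊤∣≡n)
open import Data.List as List using (List; map; length)
open import Data.List.Membership.Propositional using (_∈_; _∉_)
open import Data.List.Membership.Propositional.Properties using (∈-map⁺; ∈-map⁻; ∈-++⁺ˡ; ∈-++⁺ʳ; ∈-filter⁺; ∈-filter⁻)
open import Data.List.Relation.Unary.Any as Any using (here)
open import Data.List.Relation.Unary.Any.Properties using (any⁺; any⁻)
open import Data.Nat using (ℕ; zero; suc; pred; _+_; _*_; _∸_; z<s; NonZero; _≤_; _<_; _≤′_; ≤′-refl; ≤′-step; z≤n; s≤s; _≤ᵇ_; _<ᵇ_; _≡ᵇ_; _<?_; _≤?_; _≟_)
open import Data.Nat.Properties
open import Data.Nat.DivMod using (_%_; _/_; m≡m%n+[m/n]*n; %-congˡ; m*n%n≡0; [m+kn]%n≡m%n; m<n⇒m%n≡m; m%n<n; m%n≤m)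
open import Data.Nat.Divisibility using (divides; ∣⇒≤)
open import Data.Product using (Σ; ∃; _×_; _,_; proj₁; proj₂)
open import Data.Sum as Sum using (_⊎_; inj₁; inj₂)
open import Data.Unit using (tt)
open import Data.Vec using ([]; _∷_; lookup; tabulate)
open import Data.Vec.Properties using (tabulate∘lookup; tabulate-cong; lookup∘tabulate; lookup-zipWith; lookup-map; lookup-replicate; []=⇒lookup; lookup⇒[]=)
open import Function using (_∘_)
open import Function.Bundles using (Equivalence)
open import Relation.Nullary using (¬_; Dec; yes; no)
open import Relation.Binary using (Tri; tri<; tri≈; tri>)
open import Relation.Binary.PropositionalEquality

open import Defs

open Equivalence using (to; from)

T-not⇒¬T : ∀ {b} → T (not b) → ¬ T b
T-not⇒¬T {true} ()

<ᵇ-suc-∧-<ᵇ : ∀ a c → ((a <ᵇ suc c) ∧ (a <ᵇ c)) ≡ (a <ᵇ c)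
<ᵇ-suc-∧-<ᵇ zero    zero    = refl
<ᵇ-suc-∧-<ᵇ zero    (suc c) = refl
<ᵇ-suc-∧-<ᵇ (suc a) zero    = refl
<ᵇ-suc-∧-<ᵇ (suc a) (suc c) = <ᵇ-suc-∧-<ᵇ a c

<ᵇ-suc-∧-≮ᵇ : ∀ a c → ((a <ᵇ suc c) ∧ not (a <ᵇ c)) ≡ (a ≡ᵇ c)
<ᵇ-suc-∧-≮ᵇ zero    zero    = refl
<ᵇ-suc-∧-≮ᵇ zero    (suc c) = refl
<ᵇ-suc-∧-≮ᵇ (suc a) zero    = refl
<ᵇ-suc-∧-≮ᵇ (suc a) (suc c) = <ᵇ-suc-∧-≮ᵇ a c

¬T⇒T-not : ∀ {b} → ¬ T b → T (not b)
¬T⇒T-not {true}  ¬t = ¬t tt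
¬T⇒T-not {false} _  = tt

T-∧₃⁻ : ∀ {x y z} → T (x ∧ y ∧ z) → T x × T y × T z
T-∧₃⁻ h with to T-∧ h
... | p , q = p , to T-∧ q

T-∧₃⁺ : ∀ {x y z} → T x → T y → T z → T (x ∧ y ∧ z)
T-∧₃⁺ p q r = from T-∧ (p , from T-∧ (q , r))

∨-introˡ : ∀ x {y} → T x → T (x ∨ y)
∨-introˡ true _ = tt

∨-introʳ : ∀ x {y} → T y → T (x ∨ y)
∨-introʳ true  _ = tt
∨-introʳ false t = t

≡ᵇ-refl : ∀ m → T (m ≡ᵇ m)
≡ᵇ-refl m = ≡⇒≡ᵇ m m refl

T-allF⁻ : ∀ {n} {f : Fin n → Bool} → T (allF f) → ∀ i → T (f i)
T-allF⁻ h fz     = proj₁ (to T-∧ h)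
T-allF⁻ h (fs i) = T-allF⁻ (proj₂ (to T-∧ h)) i

T-allF⁺ : ∀ {n} {f : Fin n → Bool} → (∀ i → T (f i)) → T (allF f)
T-allF⁺ {zero}  h = tt
T-allF⁺ {suc n} h = from T-∧ (h fz , T-allF⁺ (h ∘ fs))

T-anyF⁻ : ∀ {n} {f : Fin n → Bool} → T (anyF f) → ∃ λ i → T (f i)
T-anyF⁻ {suc n} h with to T-∨ h
... | inj₁ p = fz , p
... | inj₂ p with T-anyF⁻ p
...   | i , q = fs i , q

T-anyF⁺ : ∀ {n} {f : Fin n → Bool} i → T (f i) → T (anyF f)
T-anyF⁺ fz     p = from T-∨ (inj₁ p)
T-anyF⁺ (fs i) p = from T-∨ (inj₂ (T-anyF⁺ i p))

count : ∀ {n} → (Fin n → Bool) → ℕ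
count f = ∣ tabulate f ∣

∣∣≡count : ∀ {n} (S : Subset n) → ∣ S ∣ ≡ count (lookup S)
∣∣≡count S = cong ∣_∣ (sym (tabulate∘lookup S))

count-cong : ∀ {n} {f g : Fin n → Bool} → (∀ i → f i ≡ g i) → count f ≡ count g
count-cong f≗g = cong ∣_∣ (tabulate-cong f≗g)

count-split : ∀ {n} (f g : Fin n → Bool) →
  count f ≡ count (λ i → f i ∧ g i) + count (λ i → f i ∧ not (g i))
count-split {zero}  f g = refl
count-split {suc n} f g with f fz | g fz | count-split (f ∘ fs) (g ∘ fs)
... | true  | true  | ih = cong suc ih
... | true  | false | ih = trans (cong suc ih) (sym (+-suc _ _))
... | false | _     | ih = ih

count≡0 : ∀ {n} (f : Fin n → Bool) → (∀ i → ¬ T (f i)) → count f ≡ 0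
count≡0 {zero}  f h = refl
count≡0 {suc n} f h with f fz in eq
... | true  = ⊥-elim (h fz (subst T (sym eq) tt))
... | false = count≡0 (f ∘ fs) (h ∘ fs)

count≤1 : ∀ {n} (f : Fin n → Bool) → (∀ i j → T (f i) → T (f j) → i ≡ j) → count f ≤ 1
count≤1 {zero}  f h = z≤n
count≤1 {suc n} f h with f fz in eq
... | true  = s≤s (≤-reflexive (count≡0 (f ∘ fs) λ i fi → Finₚ.0≢1+n (h fz (fs i) (subst T (sym eq) tt) fi)))
... | false = count≤1 (f ∘ fs) λ i j fi fj → Finₚ.suc-injective (h (fs i) (fs j) fi fj)

1≤count : ∀ {n} (f : Fin n → Bool) i → T (f i) → 1 ≤ count f
1≤count f fz p with f fz
... | true = s≤s z≤n
1≤count f (fs i) p with f fz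
... | true  = s≤s z≤n
... | false = 1≤count (f ∘ fs) i p

lookup-∩∁ : ∀ {n} (P M : Subset n) y → lookup (P ∩ ∁ M) y ≡ (lookup P y ∧ not (lookup M y))
lookup-∩∁ P M y = trans (lookup-zipWith _∧_ y P (∁ M)) (cong (lookup P y ∧_) (lookup-map y not M))

∣P∩∁M∣+∣M∣≡∣P∣ : ∀ {n} (P M : Subset n) → T (M ⊆ᵇ P) → ∣ P ∩ ∁ M ∣ + ∣ M ∣ ≡ ∣ P ∣
∣P∩∁M∣+∣M∣≡∣P∣ P M M⊆P = begin
  ∣ P ∩ ∁ M ∣ + ∣ M ∣                                                    ≡⟨ +-comm _ ∣ M ∣ ⟩
  ∣ M ∣ + ∣ P ∩ ∁ M ∣                                                    ≡⟨ cong₂ _+_ (∣∣≡count M) (∣∣≡count (P ∩ ∁ M)) ⟩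
  count (lookup M) + count (lookup (P ∩ ∁ M))                            ≡⟨ cong₂ _+_ (count-cong P∧M≡M) (sym (count-cong (lookup-∩∁ P M))) ⟨
  count (λ y → lookup P y ∧ lookup M y) + count (λ y → lookup P y ∧ not (lookup M y))
                                                                         ≡⟨ count-split (lookup P) (lookup M) ⟨
  count (lookup P)                                                       ≡⟨ ∣∣≡count P ⟨
  ∣ P ∣                                                                  ∎
  where
  open ≡-Reasoning
  P∧M≡M : ∀ y → (lookup P y ∧ lookup M y) ≡ lookup M y
  P∧M≡M y with lookup M y | T-allF⁻ M⊆P y
  ... | true  | My⇒Py = trans (∧-identityʳ (lookup P y)) (to T-≡ My⇒Py)
  ... | false | _     = ∧-zeroʳ (lookup P y)

m∸1+n<m : ∀ {m n} → n < m → m ∸ suc n < m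
m∸1+n<m = ∸-monoʳ-< {o = 0} z<s

m∸1+[m∸1+n]≡n : ∀ {m n} → n < m → m ∸ suc (m ∸ suc n) ≡ n
m∸1+[m∸1+n]≡n {m} {n} n<m = trans (sym (pred[m∸n]≡m∸[1+n] m (m ∸ suc n))) (cong pred (m∸[m∸n]≡n n<m))

m∸n≡1+[m∸1+n] : ∀ {m n} → n < m → m ∸ n ≡ suc (m ∸ suc n)
m∸n≡1+[m∸1+n] {m} n<m = +-∸-assoc 1 {m} n<m

hits-or-skips : (f : ℕ → ℕ) → f 0 ≡ 0 → (∀ c → f (suc c) ≤ 2 + f c) → ∀ E {j} → j ≤ f E →
  (∃ λ c → f c ≡ j) ⊎ (∃ λ c → suc (f c) ≡ j × f (suc c) ≡ suc j)
hits-or-skips f f0≡0 step zero    {j} j≤f0 = inj₁ (0 , trans f0≡0 (sym (n≤0⇒n≡0 (subst (j ≤_) f0≡0 j≤f0))))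
hits-or-skips f f0≡0 step (suc E) {j} j≤f1+E with j ≤? f E
... | yes j≤fE = hits-or-skips f f0≡0 step E j≤fE
... | no  j≰fE with m≤n⇒m<n∨m≡n j≤f1+E
...   | inj₂ j≡f1+E = inj₁ (suc E , sym j≡f1+E)
...   | inj₁ j<f1+E = inj₂ (E , 1+fE≡j , ≤-antisym (subst (f (suc E) ≤_) (cong suc 1+fE≡j) (step E)) j<f1+E)
  where
  1+fE≡j : suc (f E) ≡ j
  1+fE≡j = ≤-antisym (≰⇒> j≰fE) (≤-pred (≤-trans j<f1+E (step E)))

[m+n]%o≢m%o : ∀ m {n o} .{{_ : NonZero o}} → 0 < n → n < o → (m + n) % o ≢ m % o
[m+n]%o≢m%o m {n@(suc _)} {o} _ n<o same-residue = <⇒≱ n<o (∣⇒≤ (divides ((m + n) / o ∸ m / o) n≡))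
  where
  open ≡-Reasoning
  n+[m/o]*o≡[m+n/o]*o : n + m / o * o ≡ (m + n) / o * o
  n+[m/o]*o≡[m+n/o]*o = +-cancelˡ-≡ (m % o) _ _ (begin
    m % o + (n + m / o * o)   ≡⟨ +-assoc (m % o) n _ ⟨
    m % o + n + m / o * o     ≡⟨ cong (_+ m / o * o) (+-comm (m % o) n) ⟩
    n + m % o + m / o * o     ≡⟨ +-assoc n (m % o) _ ⟩
    n + (m % o + m / o * o)   ≡⟨ cong (n +_) (m≡m%n+[m/n]*n m o) ⟨
    n + m                     ≡⟨ +-comm n m ⟩
    m + n                     ≡⟨ m≡m%n+[m/n]*n (m + n) o ⟩
    (m + n) % o + (m + n) / o * o ≡⟨ cong (_+ (m + n) / o * o) same-residue ⟩
    m % o + (m + n) / o * o   ∎)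
  n≡ : n ≡ ((m + n) / o ∸ m / o) * o
  n≡ = begin
    n                                   ≡⟨ m+n∸n≡m n (m / o * o) ⟨
    n + m / o * o ∸ m / o * o           ≡⟨ cong (_∸ m / o * o) n+[m/o]*o≡[m+n/o]*o ⟩
    (m + n) / o * o ∸ m / o * o         ≡⟨ *-distribʳ-∸ o ((m + n) / o) (m / o) ⟨
    ((m + n) / o ∸ m / o) * o           ∎

[m∸m%n]%n≡0 : ∀ m n .{{_ : NonZero n}} → (m ∸ m % n) % n ≡ 0
[m∸m%n]%n≡0 m n = trans (%-congˡ m∸m%n≡[m/n]*n) (m*n%n≡0 (m / n) n)
  where
  m∸m%n≡[m/n]*n : m ∸ m % n ≡ m / n * n
  m∸m%n≡[m/n]*n = trans (cong (_∸ m % n) (m≡m%n+[m/n]*n m n)) (m+n∸m≡n (m % n) _)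

m%n≡1+r⇒[m∸r]%n≡1 : ∀ m n {r} .{{_ : NonZero n}} → m % n ≡ suc r → (m ∸ r) % n ≡ 1
m%n≡1+r⇒[m∸r]%n≡1 m n {r} m%n≡1+r = begin
  (m ∸ r) % n                       ≡⟨ %-congˡ (cong (_∸ r) (trans (m≡m%n+[m/n]*n m n) (cong (_+ m / n * n) m%n≡1+r))) ⟩
  (suc r + m / n * n ∸ r) % n       ≡⟨ %-congˡ (trans (cong (_∸ r) (sym (+-suc r _))) (m+n∸m≡n r _)) ⟩
  (1 + m / n * n) % n               ≡⟨ [m+kn]%n≡m%n 1 (m / n) n ⟩
  1 % n                             ≡⟨ m<n⇒m%n≡m 1<n ⟩
  1                                 ∎
  where
  open ≡-Reasoning
  1<n : 1 < n
  1<n = ≤-<-trans (s≤s z≤n) (subst (_< n) m%n≡1+r (m%n<n m n))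

[m+m]%n≢m : ∀ {m n} .{{_ : NonZero n}} → 0 < m → m < n → (m + m) % n ≢ m
[m+m]%n≢m {m} {n} 0<m m<n eq = [m+n]%o≢m%o m 0<m m<n (trans eq (sym (m<n⇒m%n≡m m<n)))

[m+m]%n≡1+m⇒m≡1 : ∀ {m n} .{{_ : NonZero n}} → (m + m) % n ≡ suc m → m ≡ 1
[m+m]%n≡1+m⇒m≡1 {zero} {suc n} ()
[m+m]%n≡1+m⇒m≡1 {suc zero}     eq = refl
[m+m]%n≡1+m⇒m≡1 {suc (suc m)} {n} eq = ⊥-elim ([m+n]%o≢m%o (3 + m) {1 + m} {n} z<s 1+m<n (begin
  (3 + m + (1 + m)) % n     ≡⟨ %-congˡ (+-suc (2 + m) (1 + m)) ⟨
  (2 + m + (2 + m)) % n     ≡⟨ eq ⟩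
  3 + m                     ≡⟨ m<n⇒m%n≡m 3+m<n ⟨
  (3 + m) % n               ∎))
  where
  open ≡-Reasoning
  3+m<n : 3 + m < n
  3+m<n = subst (_< n) eq (m%n<n _ n)
  1+m<n : suc m < n
  1+m<n = <-trans (m<n+m (suc m) {2} z<s) 3+m<n

elemᵇ⇒∈ : ∀ {m} xs → T (elemᵇ m xs) → m ∈ xs
elemᵇ⇒∈ {m} xs h = Any.map (≡ᵇ⇒≡ m _) (any⁻ (m ≡ᵇ_) xs h)

∈⇒elemᵇ : ∀ {m xs} → m ∈ xs → T (elemᵇ m xs)
∈⇒elemᵇ {m} m∈xs = any⁺ (m ≡ᵇ_) (Any.map (≡⇒≡ᵇ m _) m∈xs)

mexFrom-≥ : ∀ f m xs → m ≤ mexFrom f m xs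
mexFrom-≥ zero    m xs = ≤-refl
mexFrom-≥ (suc f) m xs with elemᵇ m xs
... | true  = ≤-trans (n≤1+n m) (mexFrom-≥ f (suc m) xs)
... | false = ≤-refl

mex≡0 : ∀ xs → 0 ∉ xs → mex xs ≡ 0
mex≡0 xs 0∉xs with elemᵇ 0 xs in eq
... | false = refl
... | true  = ⊥-elim (0∉xs (elemᵇ⇒∈ xs (subst T (sym eq) tt)))

mex≡1 : ∀ xs → 0 ∈ xs → 1 ∉ xs → mex xs ≡ 1
mex≡1 xs@(_ List.∷ _) 0∈xs 1∉xs with elemᵇ 0 xs | ∈⇒elemᵇ 0∈xs | elemᵇ 1 xs in eq
... | true | _ | false = refl
... | true | _ | true  = ⊥-elim (1∉xs (elemᵇ⇒∈ xs (subst T (sym eq) tt)))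

2≤mex : ∀ xs → 0 ∈ xs → 1 ∈ xs → 2 ≤ mex xs
2≤mex xs@(_ List.∷ ys) 0∈xs 1∈xs with elemᵇ 0 xs | ∈⇒elemᵇ 0∈xs | elemᵇ 1 xs | ∈⇒elemᵇ 1∈xs
... | true | _ | true | _ = mexFrom-≥ (length ys) 2 xs

cap : ℕ → ℕ
cap zero          = 0
cap (suc zero)    = 1
cap (suc (suc _)) = 2

cap≡cap⇒≡ : ∀ {m n} → n ≤ 1 → cap m ≡ cap n → m ≡ n
cap≡cap⇒≡ {zero}        {zero}     _ _  = refl
cap≡cap⇒≡ {suc zero}    {suc zero} _ _  = refl
cap≡cap⇒≡ {zero}        {suc zero} _ ()
cap≡cap⇒≡ {suc zero}    {zero}     _ ()
cap≡cap⇒≡ {suc (suc _)} {zero}     _ ()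
cap≡cap⇒≡ {suc (suc _)} {suc zero} _ ()
cap≡cap⇒≡ {n = suc (suc _)} (s≤s ()) _

cap≡2⇒2≤ : ∀ {m} → cap m ≡ 2 → 2 ≤ m
cap≡2⇒2≤ {suc (suc _)} _ = s≤s (s≤s z≤n)

cap≡2 : ∀ {m} → m ≢ 0 → m ≢ 1 → cap m ≡ 2
cap≡2 {zero}        m≢0 _   = ⊥-elim (m≢0 refl)
cap≡2 {suc zero}    _   m≢1 = ⊥-elim (m≢1 refl)
cap≡2 {suc (suc _)} _   _   = refl

2≤⇒cap≡2 : ∀ {m} → 2 ≤ m → cap m ≡ 2
2≤⇒cap≡2 (s≤s (s≤s _)) = refl

∈-allSubsets : ∀ {n} (S : Subset n) → S ∈ allSubsets n
∈-allSubsets []          = here refl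
∈-allSubsets (true ∷ S)  = ∈-++⁺ˡ (∈-map⁺ (true ∷_) (∈-allSubsets S))
∈-allSubsets (false ∷ S) = ∈-++⁺ʳ _ (∈-map⁺ (false ∷_) (∈-allSubsets S))

module _ {n} (G : Graph n) (L : ℕ → Bool) (P : Subset n) where

  ∈-options⁺ : ∀ {M} → T (legalMove G L P M) → P ∩ ∁ M ∈ options G L P
  ∈-options⁺ {M} legal = ∈-map⁺ (λ M → P ∩ ∁ M) (∈-filter⁺ (T? ∘ legalMove G L P) (∈-allSubsets M) legal)

  ∈-options⁻ : ∀ {Q} → Q ∈ options G L P → ∃ λ M → T (legalMove G L P M) × Q ≡ P ∩ ∁ M
  ∈-options⁻ Q∈ with ∈-map⁻ (λ M → P ∩ ∁ M) Q∈
  ... | M , M∈ , refl = M , proj₂ (∈-filter⁻ (T? ∘ legalMove G L P) {xs = allSubsets n} M∈) , refl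

legalMove-I⁻ : ∀ {n} (G : Graph n) N (P M : Subset n) → T (legalMove G (I N) P M) →
  T (M ⊆ᵇ P) × 1 ≤ ∣ M ∣ × ∣ M ∣ ≤ N × T (connected G (P ∩ ∁ M))
legalMove-I⁻ G N P M legal with to (T-∧ {M ⊆ᵇ P}) legal
... | M⊆P , legal₁ with to (T-∧ {1 ≤ᵇ ∣ M ∣}) legal₁
...   | 1≤∣M∣ , legal₂ with to (T-∧ {I N ∣ M ∣}) legal₂
...     | M∈I , legal₃ =
  M⊆P , ≤ᵇ⇒≤ 1 _ 1≤∣M∣ , ≤ᵇ⇒≤ _ N (proj₂ (to (T-∧ {1 ≤ᵇ ∣ M ∣}) M∈I)) ,
  proj₂ (to (T-∧ {connected G M}) legal₃)

-- Reachability

module Reachability {n} (G : Graph n) (S : Subset n) (u : Fin n) where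

  reachIn : ℕ → Subset n
  reachIn m = iterate (step G S) m ⁅ u ⁆

  lookup-step : ∀ R v →
    lookup (step G S R) v ≡ (lookup R v ∨ (lookup S v ∧ anyF (λ w → lookup R w ∧ G w v)))
  lookup-step R v = lookup∘tabulate _ v

  u∈reachIn0 : T (lookup (reachIn 0) u)
  u∈reachIn0 = from T-≡ ([]=⇒lookup (x∈⁅x⁆ u))

  reachIn-suc⁺ : ∀ m v → T (lookup (reachIn m) v) → T (lookup (reachIn (suc m)) v)
  reachIn-suc⁺ m v h rewrite lookup-step (reachIn m) v = from T-∨ (inj₁ h)

  reachIn-mono : ∀ {m m′} v → m ≤ m′ → T (lookup (reachIn m) v) → T (lookup (reachIn m′) v)
  reachIn-mono v m≤m′ = go (≤⇒≤′ m≤m′)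
    where
    go : ∀ {m m′} → m ≤′ m′ → T (lookup (reachIn m) v) → T (lookup (reachIn m′) v)
    go ≤′-refl        h = h
    go {m′ = suc m′} (≤′-step m≤m′) h = reachIn-suc⁺ m′ v (go m≤m′ h)

  reachIn-edge : ∀ m w v → T (lookup (reachIn m) w) → T (lookup S v) → T (G w v) →
    T (lookup (reachIn (suc m)) v)
  reachIn-edge m w v w∈ v∈S e rewrite lookup-step (reachIn m) v =
    from T-∨ (inj₂ (from T-∧ (v∈S , T-anyF⁺ w (from T-∧ (w∈ , e)))))

  reachIn-closed : (A : Fin n → Set) → A u →
    (∀ w v → A w → T (lookup S v) → T (G w v) → A v) →
    ∀ m v → T (lookup (reachIn m) v) → A v
  reachIn-closed A Au closed zero v h =
    subst A (sym (x∈⁅y⁆⇒x≡y u (lookup⇒[]= v ⁅ u ⁆ (to T-≡ h)))) Au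
  reachIn-closed A Au closed (suc m) v h rewrite lookup-step (reachIn m) v with to T-∨ h
  ... | inj₁ h′ = reachIn-closed A Au closed m v h′
  ... | inj₂ h′ with to T-∧ h′
  ...   | v∈S , e with T-anyF⁻ {f = λ w → lookup (reachIn m) w ∧ G w v} e
  ...     | w , e′ with to T-∧ e′
  ...       | w∈ , wv = closed w v (reachIn-closed A Au closed m w w∈) v∈S wv

module _ {n} {G : Graph n} {S : Subset n} where

  connected⁻ : T (connected G S) → ∀ {u v} → T (lookup S u) → T (lookup S v) →
    T (lookup (reach G S u) v)
  connected⁻ c {u} {v} u∈S v∈S with to T-∨ (T-allF⁻ (T-allF⁻ c u) v)
  ... | inj₁ h = ⊥-elim (T-not⇒¬T h (from T-∧ (u∈S , v∈S)))
  ... | inj₂ h = h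

  connected⁺ : (∀ u v → T (lookup S u) → T (lookup S v) → T (lookup (reach G S u) v)) →
    T (connected G S)
  connected⁺ h = T-allF⁺ λ u → T-allF⁺ λ v → joined u v
    where
    joined : ∀ u v → T (not (lookup S u ∧ lookup S v) ∨ lookup (reach G S u) v)
    joined u v with lookup S u in u∈S | lookup S v in v∈S
    ... | true  | true  = h u v (from T-≡ u∈S) (from T-≡ v∈S)
    ... | true  | false = tt
    ... | false | _     = tt

module Star (k ℓ : ℕ) where

  -- Labels are those of Defs. The spine is the path k+1, …, 2, 0, k+2, …, k+ℓ+1, and
  -- `position a` is the place of label a on it; the pendant vertex 1 shares the centre's place k.
  position : ℕ → ℕ
  position zero          = k
  position (suc zero)    = k
  position (suc (suc a)) with a <? k
  ... | yes _ = k ∸ suc a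
  ... | no  _ = suc a

  position-leg₁ : ∀ {a} → a < k → position (2 + a) ≡ k ∸ suc a
  position-leg₁ {a} a<k with a <? k
  ... | yes _   = refl
  ... | no  a≮k = ⊥-elim (a≮k a<k)

  position-leg₂ : ∀ {a} → k ≤ a → position (2 + a) ≡ suc a
  position-leg₂ {a} k≤a with a <? k
  ... | yes a<k = ⊥-elim (<⇒≱ a<k k≤a)
  ... | no  _   = refl

  data StarEdge : ℕ → ℕ → Set where
    centre-pendant : StarEdge 0 1
    centre-leg₁    : 1 ≤ k → StarEdge 0 2
    along-leg₁     : ∀ {a} → 2 ≤ a → a ≤ k → StarEdge a (suc a)
    centre-leg₂    : 1 ≤ ℓ → StarEdge 0 (k + 2)
    along-leg₂     : ∀ {a} → k + 2 ≤ a → a ≤ k + ℓ → StarEdge a (suc a)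

  starEdge⁻ : ∀ {a b} → T (starEdge k ℓ a b) → StarEdge a b
  starEdge⁻ {a} {b} h with to T-∨ h
  ... | inj₁ d₁ with to T-∧ d₁
  ...   | a≡0 , b≡1 = subst₂ StarEdge (sym (≡ᵇ⇒≡ a 0 a≡0)) (sym (≡ᵇ⇒≡ b 1 b≡1)) centre-pendant
  starEdge⁻ {a} {b} h | inj₂ h₁ with to T-∨ h₁
  ... | inj₁ d₂ with T-∧₃⁻ d₂
  ...   | a≡0 , b≡2 , 1≤k =
    subst₂ StarEdge (sym (≡ᵇ⇒≡ a 0 a≡0)) (sym (≡ᵇ⇒≡ b 2 b≡2)) (centre-leg₁ (≤ᵇ⇒≤ 1 k 1≤k))
  starEdge⁻ {a} {b} h | inj₂ h₁ | inj₂ h₂ with to T-∨ h₂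
  ... | inj₁ d₃ with T-∧₃⁻ d₃
  ...   | 2≤a , a≤k , b≡1+a =
    subst (StarEdge a) (sym (≡ᵇ⇒≡ b (suc a) b≡1+a)) (along-leg₁ (≤ᵇ⇒≤ 2 a 2≤a) (≤ᵇ⇒≤ a k a≤k))
  starEdge⁻ {a} {b} h | inj₂ h₁ | inj₂ h₂ | inj₂ h₃ with to T-∨ h₃
  ... | inj₁ d₄ with T-∧₃⁻ d₄
  ...   | a≡0 , b≡k+2 , 1≤ℓ =
    subst₂ StarEdge (sym (≡ᵇ⇒≡ a 0 a≡0)) (sym (≡ᵇ⇒≡ b (k + 2) b≡k+2)) (centre-leg₂ (≤ᵇ⇒≤ 1 ℓ 1≤ℓ))
  starEdge⁻ {a} {b} h | inj₂ h₁ | inj₂ h₂ | inj₂ h₃ | inj₂ d₅ with T-∧₃⁻ d₅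
  ... | k+2≤a , a≤K , b≡1+a =
    subst (StarEdge a) (sym (≡ᵇ⇒≡ b (suc a) b≡1+a)) (along-leg₂ (≤ᵇ⇒≤ (k + 2) a k+2≤a) (≤ᵇ⇒≤ a (k + ℓ) a≤K))

  starEdge⁺ : ∀ {a b} → StarEdge a b → T (starEdge k ℓ a b)
  starEdge⁺ centre-pendant      = tt
  starEdge⁺ (centre-leg₁ 1≤k)   = ∨-introˡ (1 ≤ᵇ k) (≤⇒≤ᵇ 1≤k)
  starEdge⁺ (along-leg₁ {a} 2≤a a≤k) =
    ∨-introʳ ((a ≡ᵇ 0) ∧ (suc a ≡ᵇ 1)) (∨-introʳ ((a ≡ᵇ 0) ∧ (suc a ≡ᵇ 2) ∧ (1 ≤ᵇ k))
      (∨-introˡ ((2 ≤ᵇ a) ∧ (a ≤ᵇ k) ∧ (suc a ≡ᵇ suc a)) (T-∧₃⁺ (≤⇒≤ᵇ 2≤a) (≤⇒≤ᵇ a≤k) (≡ᵇ-refl a))))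
  starEdge⁺ (centre-leg₂ 1≤ℓ)   =
    ∨-introʳ (k + 2 ≡ᵇ 1) (∨-introʳ ((k + 2 ≡ᵇ 2) ∧ (1 ≤ᵇ k))
      (∨-introˡ ((k + 2 ≡ᵇ k + 2) ∧ (1 ≤ᵇ ℓ)) (from T-∧ (≡ᵇ-refl (k + 2) , ≤⇒≤ᵇ 1≤ℓ))))
  starEdge⁺ (along-leg₂ {a} k+2≤a a≤K) =
    ∨-introʳ ((a ≡ᵇ 0) ∧ (suc a ≡ᵇ 1)) (∨-introʳ ((a ≡ᵇ 0) ∧ (suc a ≡ᵇ 2) ∧ (1 ≤ᵇ k))
      (∨-introʳ ((2 ≤ᵇ a) ∧ (a ≤ᵇ k) ∧ (suc a ≡ᵇ suc a)) (∨-introʳ ((a ≡ᵇ 0) ∧ (suc a ≡ᵇ k + 2) ∧ (1 ≤ᵇ ℓ))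
        (T-∧₃⁺ (≤⇒≤ᵇ k+2≤a) (≤⇒≤ᵇ a≤K) (≡ᵇ-refl a)))))

  spine : ℕ → ℕ
  spine c with <-cmp c k
  ... | tri< _ _ _ = 2 + (k ∸ suc c)
  ... | tri≈ _ _ _ = 0
  ... | tri> _ _ _ = suc c

  spine-leg₁ : ∀ {c} → c < k → spine c ≡ 2 + (k ∸ suc c)
  spine-leg₁ {c} c<k with <-cmp c k
  ... | tri< _ _ _    = refl
  ... | tri≈ c≮k _ _  = ⊥-elim (c≮k c<k)
  ... | tri> c≮k _ _  = ⊥-elim (c≮k c<k)

  spine-centre : spine k ≡ 0
  spine-centre with <-cmp k k
  ... | tri< _ k≢k _ = ⊥-elim (k≢k refl)
  ... | tri≈ _ _ _   = refl
  ... | tri> _ k≢k _ = ⊥-elim (k≢k refl)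

  spine-leg₂ : ∀ {c} → k < c → spine c ≡ suc c
  spine-leg₂ {c} k<c with <-cmp c k
  ... | tri< _ _ k≮c = ⊥-elim (k≮c k<c)
  ... | tri≈ _ _ k≮c = ⊥-elim (k≮c k<c)
  ... | tri> _ _ _   = refl

  spine∘position : ∀ {a} → a ≢ 1 → spine (position a) ≡ a
  spine∘position {zero}        _ = spine-centre
  spine∘position {suc zero}    a≢1 = ⊥-elim (a≢1 refl)
  spine∘position {suc (suc a)} _ with a <? k
  ... | yes a<k = trans (spine-leg₁ (m∸1+n<m a<k)) (cong (2 +_) (m∸1+[m∸1+n]≡n a<k))
  ... | no  a≮k = spine-leg₂ (s≤s (≮⇒≥ a≮k))

  position-injective : ∀ {a b} → a ≢ 1 → b ≢ 1 → position a ≡ position b → a ≡ b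
  position-injective {a} {b} a≢1 b≢1 eq =
    trans (sym (spine∘position a≢1)) (trans (cong spine eq) (spine∘position b≢1))

  position∘spine : ∀ c → position (spine c) ≡ c
  position∘spine c with <-cmp c k
  ... | tri< c<k _ _ = trans (position-leg₁ (m∸1+n<m c<k)) (m∸1+[m∸1+n]≡n c<k)
  ... | tri≈ _ c≡k _ = sym c≡k
  position∘spine (suc c) | tri> _ _ (s≤s k≤c) = position-leg₂ k≤c

  spine≢1 : ∀ c → spine c ≢ 1
  spine≢1 c with <-cmp c k
  ... | tri< _ _ _ = λ ()
  ... | tri≈ _ _ _ = λ ()
  spine≢1 (suc c) | tri> _ _ _ = λ ()

  spine< : ∀ {c} → c ≤ k + ℓ → spine c < k + ℓ + 2
  spine< {c} c≤K rewrite +-comm (k + ℓ) 2 with <-cmp c k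
  ... | tri< c<k _ _ = s≤s (s≤s (≤-trans (m∸1+n<m c<k) (m≤m+n k ℓ)))
  ... | tri≈ _ _ _   = s≤s z≤n
  ... | tri> _ _ _   = s≤s (s≤s c≤K)

  position≤ : ∀ {a} → a < k + ℓ + 2 → position a ≤ k + ℓ
  position≤ {zero}        _ = m≤m+n k ℓ
  position≤ {suc zero}    _ = m≤m+n k ℓ
  position≤ {suc (suc a)} a<n with a <? k
  ... | yes _ = ≤-trans (m∸n≤m k (suc a)) (m≤m+n k ℓ)
  ... | no  _ = ≤-pred (≤-pred (subst (3 + a ≤_) (+-comm (k + ℓ) 2) a<n))

  SpineEdge : ℕ → ℕ → Set
  SpineEdge a b = a ≢ 1 × b ≢ 1 × (position a ≡ suc (position b) ⊎ position b ≡ suc (position a))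

  SpineEdge-sym : ∀ {a b} → SpineEdge a b → SpineEdge b a
  SpineEdge-sym (a≢1 , b≢1 , steps) = b≢1 , a≢1 , Sum.swap steps

  StarEdge⇒SpineEdge : ∀ {a b} → StarEdge a b → (a ≡ 0 × b ≡ 1) ⊎ SpineEdge a b
  StarEdge⇒SpineEdge centre-pendant = inj₁ (refl , refl)
  StarEdge⇒SpineEdge (centre-leg₁ 1≤k) =
    inj₂ ((λ ()) , (λ ()) , inj₁ (trans (m∸n≡1+[m∸1+n] 1≤k) (cong suc (sym (position-leg₁ 1≤k)))))
  StarEdge⇒SpineEdge (along-leg₁ {suc (suc a)} (s≤s (s≤s _)) a<k) =
    inj₂ ((λ ()) , (λ ()) , inj₁ (begin
      position (2 + a)          ≡⟨ position-leg₁ (<-trans (n<1+n a) a<k) ⟩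
      k ∸ suc a                 ≡⟨ m∸n≡1+[m∸1+n] a<k ⟩
      suc (k ∸ suc (suc a))     ≡⟨ cong suc (position-leg₁ a<k) ⟨
      suc (position (3 + a))    ∎))
    where open ≡-Reasoning
  StarEdge⇒SpineEdge (centre-leg₂ _) =
    inj₂ ((λ ()) , k+2≢1 , inj₂ (trans (cong position (+-comm k 2)) (position-leg₂ ≤-refl)))
    where
    k+2≢1 : k + 2 ≢ 1
    k+2≢1 e = 1+n≢0 (suc-injective (trans (+-comm 2 k) e))
  StarEdge⇒SpineEdge (along-leg₂ {a} k+2≤a _) with subst (_≤ a) (+-comm k 2) k+2≤a
  ... | s≤s (s≤s {n = a′} k≤a′) = inj₂ ((λ ()) , (λ ()) ,
        inj₂ (trans (position-leg₂ (m≤n⇒m≤1+n k≤a′)) (cong suc (sym (position-leg₂ k≤a′)))))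

  Edge : ℕ → ℕ → Set
  Edge a b = T (starEdge k ℓ a b ∨ starEdge k ℓ b a)

  Edge⇒ : ∀ {a b} → Edge a b → (a ≡ 0 × b ≡ 1) ⊎ (a ≡ 1 × b ≡ 0) ⊎ SpineEdge a b
  Edge⇒ {a} {b} e with to T-∨ e
  ... | inj₁ ab with StarEdge⇒SpineEdge (starEdge⁻ ab)
  ...   | inj₁ a,b≡0,1   = inj₁ a,b≡0,1
  ...   | inj₂ spineEdge = inj₂ (inj₂ spineEdge)
  Edge⇒ {a} {b} e | inj₂ ba with StarEdge⇒SpineEdge (starEdge⁻ ba)
  ...   | inj₁ (b≡0 , a≡1) = inj₂ (inj₁ (a≡1 , b≡0))
  ...   | inj₂ spineEdge   = inj₂ (inj₂ (SpineEdge-sym spineEdge))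

  StarEdge⇒Edge : ∀ {a b} → StarEdge a b → Edge a b
  StarEdge⇒Edge {a} {b} e = ∨-introˡ (starEdge k ℓ a b) (starEdge⁺ e)

  StarEdge⇒Edge′ : ∀ {a b} → StarEdge b a → Edge a b
  StarEdge⇒Edge′ {a} {b} e = ∨-introʳ (starEdge k ℓ a b) (starEdge⁺ e)

  spine-adjacent : ∀ {c} → c < k + ℓ → Edge (spine c) (spine (suc c))
  spine-adjacent {c} c<K = adjacent (<-cmp (suc c) k)
    where
    adjacent : Tri (suc c < k) (suc c ≡ k) (k < suc c) → Edge (spine c) (spine (suc c))
    adjacent (tri< 1+c<k _ _) =
      subst₂ Edge (sym spine-c) (sym (spine-leg₁ 1+c<k)) (StarEdge⇒Edge′ (along-leg₁ (s≤s (s≤s z≤n)) 2+d≤k))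
      where
      spine-c : spine c ≡ suc (2 + (k ∸ suc (suc c)))
      spine-c = trans (spine-leg₁ (<-trans (n<1+n c) 1+c<k)) (cong (2 +_) (m∸n≡1+[m∸1+n] 1+c<k))
      2+d≤k : 2 + (k ∸ suc (suc c)) ≤ k
      2+d≤k = subst (2 + (k ∸ suc (suc c)) ≤_) (m+[n∸m]≡n (≤-trans (s≤s (s≤s z≤n)) 1+c<k))
                (+-monoʳ-≤ 2 (∸-monoʳ-≤ k (s≤s (s≤s z≤n))))
    adjacent (tri≈ _ 1+c≡k _) =
      subst₂ Edge (sym spine-c) (sym (trans (cong spine 1+c≡k) spine-centre))
        (StarEdge⇒Edge′ (centre-leg₁ (subst (1 ≤_) 1+c≡k (s≤s z≤n))))
      where
      spine-c : spine c ≡ 2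
      spine-c = trans (spine-leg₁ (≤-reflexive 1+c≡k))
                  (cong (2 +_) (trans (cong (_∸ suc c) (sym 1+c≡k)) (n∸n≡0 (suc c))))
    adjacent (tri> _ _ (s≤s k≤c)) with m≤n⇒m<n∨m≡n k≤c
    ... | inj₂ refl =
      subst₂ Edge (sym spine-centre) (sym (trans (spine-leg₂ (n<1+n c)) (+-comm 2 c)))
        (StarEdge⇒Edge (centre-leg₂ (+-cancelˡ-≤ c 1 ℓ (subst (_≤ c + ℓ) (+-comm 1 c) c<K))))
    ... | inj₁ k<c =
      subst₂ Edge (sym (spine-leg₂ k<c)) (sym (spine-leg₂ (m≤n⇒m≤1+n k<c)))
        (StarEdge⇒Edge (along-leg₂ (subst (_≤ suc c) (+-comm 2 k) (s≤s k<c)) c<K))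

  V : Set
  V = Fin (k + ℓ + 2)

  G : Graph (k + ℓ + 2)
  G = S1 k ℓ

  G-sym : ∀ y z → T (G y z) → T (G z y)
  G-sym y z = subst T (∨-comm (starEdge k ℓ (toℕ y) (toℕ z)) (starEdge k ℓ (toℕ z) (toℕ y)))

  pos : V → ℕ
  pos y = position (toℕ y)

  OnSpine : V → Set
  OnSpine y = toℕ y ≢ 1

  centre pendant : V
  centre  = fromℕ< (≤-trans (s≤s z≤n) (m≤n+m 2 (k + ℓ)))
  pendant = fromℕ< (m≤n+m 2 (k + ℓ))

  toℕ-centre : toℕ centre ≡ 0
  toℕ-centre = toℕ-fromℕ< _

  toℕ-pendant : toℕ pendant ≡ 1
  toℕ-pendant = toℕ-fromℕ< _

  pos-centre : pos centre ≡ k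
  pos-centre = cong position toℕ-centre

  pos-pendant : pos pendant ≡ k
  pos-pendant = cong position toℕ-pendant

  centre-OnSpine : OnSpine centre
  centre-OnSpine eq = 0≢1+n (trans (sym toℕ-centre) eq)

  pendant-¬OnSpine : ¬ OnSpine pendant
  pendant-¬OnSpine ¬eq = ¬eq toℕ-pendant

  OnSpine-or-pendant : ∀ y → OnSpine y ⊎ y ≡ pendant
  OnSpine-or-pendant y with toℕ y ≟ 1
  ... | yes eq = inj₂ (toℕ-injective (trans eq (sym toℕ-pendant)))
  ... | no ¬eq = inj₁ ¬eq

  pos≤ : ∀ y → pos y ≤ k + ℓ
  pos≤ y = position≤ (toℕ<n y)

  pos-injective : ∀ {y z} → OnSpine y → OnSpine z → pos y ≡ pos z → y ≡ z
  pos-injective y∈ z∈ eq = toℕ-injective (position-injective y∈ z∈ eq)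

  G⇒ : ∀ y z → T (G y z) →
    (y ≡ centre × z ≡ pendant) ⊎ (y ≡ pendant × z ≡ centre) ⊎
    (OnSpine y × OnSpine z × (pos y ≡ suc (pos z) ⊎ pos z ≡ suc (pos y)))
  G⇒ y z e with Edge⇒ e
  ... | inj₁ (y≡0 , z≡1) =
    inj₁ (toℕ-injective (trans y≡0 (sym toℕ-centre)) , toℕ-injective (trans z≡1 (sym toℕ-pendant)))
  ... | inj₂ (inj₁ (y≡1 , z≡0)) =
    inj₂ (inj₁ (toℕ-injective (trans y≡1 (sym toℕ-pendant)) , toℕ-injective (trans z≡0 (sym toℕ-centre))))
  ... | inj₂ (inj₂ spineEdge) = inj₂ (inj₂ spineEdge)

  G-centre-pendant : T (G centre pendant)
  G-centre-pendant = subst₂ Edge (sym toℕ-centre) (sym toℕ-pendant) (StarEdge⇒Edge centre-pendant)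

  spineAt : ∀ c → c ≤ k + ℓ → V
  spineAt c c≤K = fromℕ< (spine< c≤K)

  toℕ-spineAt : ∀ {c} (c≤K : c ≤ k + ℓ) → toℕ (spineAt c c≤K) ≡ spine c
  toℕ-spineAt c≤K = toℕ-fromℕ< (spine< c≤K)

  spineAt-OnSpine : ∀ {c} (c≤K : c ≤ k + ℓ) → OnSpine (spineAt c c≤K)
  spineAt-OnSpine {c} c≤K eq = spine≢1 c (trans (sym (toℕ-spineAt c≤K)) eq)

  pos-spineAt : ∀ {c} (c≤K : c ≤ k + ℓ) → pos (spineAt c c≤K) ≡ c
  pos-spineAt {c} c≤K = trans (cong position (toℕ-spineAt c≤K)) (position∘spine c)

  G-spineAt : ∀ {c} (c<K : c < k + ℓ) → T (G (spineAt c (<⇒≤ c<K)) (spineAt (suc c) c<K))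
  G-spineAt c<K = subst₂ Edge (sym (toℕ-spineAt (<⇒≤ c<K))) (sym (toℕ-spineAt c<K)) (spine-adjacent c<K)

  spine-up : ∀ {y} → OnSpine y → pos y < k + ℓ →
    Σ V λ z → OnSpine z × pos z ≡ suc (pos y) × T (G y z)
  spine-up {y} y∈ py<K = z , spineAt-OnSpine py<K , pos-spineAt py<K , subst (λ x → T (G x z)) y′≡y (G-spineAt py<K)
    where
    z : V
    z = spineAt (suc (pos y)) py<K
    y′≡y : spineAt (pos y) (<⇒≤ py<K) ≡ y
    y′≡y = pos-injective (spineAt-OnSpine (<⇒≤ py<K)) y∈ (pos-spineAt (<⇒≤ py<K))

  spine-down : ∀ {y c} → OnSpine y → pos y ≡ suc c →
    Σ V λ z → OnSpine z × pos z ≡ c × T (G y z)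
  spine-down {y} {c} y∈ py≡1+c =
    z , spineAt-OnSpine (<⇒≤ c<K) , pos-spineAt (<⇒≤ c<K) , G-sym z y (subst (λ x → T (G z x)) y′≡y (G-spineAt c<K))
    where
    c<K : c < k + ℓ
    c<K = subst (_≤ k + ℓ) py≡1+c (pos≤ y)
    z : V
    z = spineAt c (<⇒≤ c<K)
    y′≡y : spineAt (suc c) c<K ≡ y
    y′≡y = pos-injective (spineAt-OnSpine c<K) y∈ (trans (pos-spineAt c<K) (sym py≡1+c))

  -- Connected sets are the convex ones

  SpineConvex : (V → Bool) → Set
  SpineConvex X = ∀ {u x w} → OnSpine u → OnSpine x → OnSpine w →
    T (X u) → T (X w) → pos u ≤ pos x → pos x ≤ pos w → T (X x)

  PendantAttached : (V → Bool) → Set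
  PendantAttached X = T (X pendant) → T (X centre) ⊎ (∀ y → T (X y) → y ≡ pendant)

  Convex : (V → Bool) → Set
  Convex X = SpineConvex X × PendantAttached X

  Convex-cong : ∀ {X Y} → (∀ y → X y ≡ Y y) → Convex X → Convex Y
  Convex-cong {X} {Y} X≗Y (convex , attached) =
      (λ u∈ x∈ w∈ Yu Yw ux xw → ≗⁺ _ (convex u∈ x∈ w∈ (≗⁻ _ Yu) (≗⁻ _ Yw) ux xw))
    , (λ Yp → Sum.map (≗⁺ centre) (λ only y Yy → only y (≗⁻ y Yy)) (attached (≗⁻ pendant Yp)))
    where
    ≗⁺ : ∀ y → T (X y) → T (Y y)
    ≗⁺ y = subst T (X≗Y y)
    ≗⁻ : ∀ y → T (Y y) → T (X y)
    ≗⁻ y = subst T (sym (X≗Y y))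

  pendant≢centre : pendant ≢ centre
  pendant≢centre eq = 1+n≢0 (trans (sym toℕ-pendant) (trans (cong toℕ eq) toℕ-centre))

  connected⇒Convex : ∀ S → T (connected G S) → Convex (lookup S)
  connected⇒Convex S conn = convex , attached
    where
    open Reachability G S

    pos-separates : ∀ {y x} → OnSpine y → OnSpine x → T (lookup S y) → ¬ T (lookup S x) → pos y ≢ pos x
    pos-separates y∈ x∈ Sy ¬Sx eq = ¬Sx (subst (T ∘ lookup S) (pos-injective y∈ x∈ eq) Sy)

    -- If x ∉ S, the vertices before x on the spine are closed under steps inside S,
    -- so w is not reachable from u.
    convex : SpineConvex (lookup S)
    convex {u} {x} {w} u∈ x∈ w∈ Su Sw ux xw with T? (lookup S x)
    ... | yes Sx = Sx
    ... | no ¬Sx = ⊥-elim (<⇒≱ (reachIn-closed u (λ y → pos y < pos x) pu<px closed (k + ℓ + 2) w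
                                    (connected⁻ {G = G} {S = S} conn Su Sw)) xw)
      where
      pu<px : pos u < pos x
      pu<px = ≤∧≢⇒< ux (pos-separates u∈ x∈ Su ¬Sx)
      closed : ∀ y z → pos y < pos x → T (lookup S z) → T (G y z) → pos z < pos x
      closed y z py<px Sz e with G⇒ y z e
      ... | inj₁ (refl , refl) = subst (_< pos x) (trans pos-centre (sym pos-pendant)) py<px
      ... | inj₂ (inj₁ (refl , refl)) = subst (_< pos x) (trans pos-pendant (sym pos-centre)) py<px
      ... | inj₂ (inj₂ (_ , z∈ , inj₁ py≡1+pz)) = <-trans (subst (pos z <_) (sym py≡1+pz) (n<1+n _)) py<px
      ... | inj₂ (inj₂ (_ , z∈ , inj₂ pz≡1+py)) =
        ≤∧≢⇒< (subst (_≤ pos x) (sym pz≡1+py) py<px) (pos-separates z∈ x∈ Sz ¬Sx)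

    attached : PendantAttached (lookup S)
    attached Sp with T? (lookup S centre)
    ... | yes Sc  = inj₁ Sc
    ... | no  ¬Sc = inj₂ λ y Sy → reachIn-closed pendant (_≡ pendant) refl closed (k + ℓ + 2) y (connected⁻ {G = G} {S = S} conn Sp Sy)
      where
      closed : ∀ y z → y ≡ pendant → T (lookup S z) → T (G y z) → z ≡ pendant
      closed y z refl Sz e with G⇒ y z e
      ... | inj₁ (p≡c , _)           = ⊥-elim (pendant≢centre p≡c)
      ... | inj₂ (inj₁ (_ , refl))   = ⊥-elim (¬Sc Sz)
      ... | inj₂ (inj₂ (p∈ , _ , _)) = ⊥-elim (pendant-¬OnSpine p∈)

  module Walk (S : Subset (k + ℓ + 2)) (convex : SpineConvex (lookup S)) (u : V) where
    open Reachability G S u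

    walk-up : ∀ d m {y w} → OnSpine y → OnSpine w → T (lookup S y) → T (lookup S w) →
      pos y + d ≡ pos w → T (lookup (reachIn m) y) → T (lookup (reachIn (d + m)) w)
    walk-up zero m y∈ w∈ Sy Sw py≡pw y∈R =
      subst (T ∘ lookup (reachIn m)) (pos-injective y∈ w∈ (trans (sym (+-identityʳ _)) py≡pw)) y∈R
    walk-up (suc d) m {y} {w} y∈ w∈ Sy Sw py+d≡pw y∈R
      with spine-up y∈ (<-≤-trans (subst (pos y <_) py+d≡pw (m<m+n (pos y) (s≤s z≤n))) (pos≤ w))
    ... | z , z∈ , pz≡1+py , yz = subst (λ i → T (lookup (reachIn i) w)) (+-suc d m)
          (walk-up d (suc m) z∈ w∈ Sz Sw pz+d≡pw (reachIn-edge m y z y∈R Sz yz))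
      where
      pz+d≡pw : pos z + d ≡ pos w
      pz+d≡pw = trans (cong (_+ d) pz≡1+py) (trans (sym (+-suc (pos y) d)) py+d≡pw)
      Sz : T (lookup S z)
      Sz = convex y∈ z∈ w∈ Sy Sw (subst (pos y ≤_) (sym pz≡1+py) (n≤1+n _)) (subst (pos z ≤_) pz+d≡pw (m≤m+n _ d))

    walk-down : ∀ d m {y w} → OnSpine y → OnSpine w → T (lookup S y) → T (lookup S w) →
      pos w + d ≡ pos y → T (lookup (reachIn m) y) → T (lookup (reachIn (d + m)) w)
    walk-down zero m y∈ w∈ Sy Sw pw≡py y∈R =
      subst (T ∘ lookup (reachIn m)) (pos-injective y∈ w∈ (sym (trans (sym (+-identityʳ _)) pw≡py))) y∈R
    walk-down (suc d) m {y} {w} y∈ w∈ Sy Sw pw+d≡py y∈R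
      with spine-down y∈ (trans (sym pw+d≡py) (+-suc (pos w) d))
    ... | z , z∈ , pz≡pw+d , yz = subst (λ i → T (lookup (reachIn i) w)) (+-suc d m)
          (walk-down d (suc m) z∈ w∈ Sz Sw (sym pz≡pw+d) (reachIn-edge m y z y∈R Sz yz))
      where
      Sz : T (lookup S z)
      Sz = convex w∈ z∈ y∈ Sw Sy (subst (pos w ≤_) (sym pz≡pw+d) (m≤m+n _ d))
             (subst (_≤ pos y) (sym pz≡pw+d) (subst (pos w + d ≤_) pw+d≡py (+-monoʳ-≤ (pos w) (n≤1+n d))))

    private
      distance≤ : ∀ {a b m} → a ≤ k + ℓ → a ∸ b + m ≤ m + (k + ℓ)
      distance≤ {a} {b} {m} a≤K = subst (_≤ m + (k + ℓ)) (+-comm m _) (+-monoʳ-≤ m (≤-trans (m∸n≤m a b) a≤K))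

    walk : ∀ m {y w} → OnSpine y → OnSpine w → T (lookup S y) → T (lookup S w) →
      T (lookup (reachIn m) y) → T (lookup (reachIn (m + (k + ℓ))) w)
    walk m {y} {w} y∈ w∈ Sy Sw y∈R with ≤-total (pos y) (pos w)
    ... | inj₁ py≤pw = reachIn-mono w (distance≤ {b = pos y} (pos≤ w)) (walk-up (pos w ∸ pos y) m y∈ w∈ Sy Sw (m+[n∸m]≡n py≤pw) y∈R)
    ... | inj₂ pw≤py = reachIn-mono w (distance≤ {b = pos w} (pos≤ y)) (walk-down (pos y ∸ pos w) m y∈ w∈ Sy Sw (m+[n∸m]≡n pw≤py) y∈R)

  Convex⇒connected : ∀ S → Convex (lookup S) → T (connected G S)
  Convex⇒connected S (convex , attached) = connected⁺ {G = G} {S = S} joined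
    where
    1+K≤n : suc (k + ℓ) ≤ k + ℓ + 2
    1+K≤n = subst (suc (k + ℓ) ≤_) (+-comm 2 (k + ℓ)) (n≤1+n _)

    joined : ∀ u v → T (lookup S u) → T (lookup S v) → T (lookup (reach G S u) v)
    joined u v Su Sv with OnSpine-or-pendant u | OnSpine-or-pendant v
    ... | inj₁ u∈   | inj₁ v∈   = reachIn-mono v (≤-trans (n≤1+n _) 1+K≤n) (walk 0 u∈ v∈ Su Sv u∈reachIn0)
      where open Reachability G S u
            open Walk S convex u
    ... | inj₂ refl | inj₂ refl = reachIn-mono u (z≤n {k + ℓ + 2}) u∈reachIn0
      where open Reachability G S u
    ... | inj₂ refl | inj₁ v∈ with attached Su
    ...   | inj₁ Sc   = reachIn-mono v 1+K≤n (walk 1 centre-OnSpine v∈ Sc Sv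
                          (reachIn-edge 0 u centre u∈reachIn0 Sc (G-sym centre pendant G-centre-pendant)))
      where open Reachability G S u
            open Walk S convex u
    ...   | inj₂ only = ⊥-elim (pendant-¬OnSpine (subst OnSpine (only v Sv) v∈))
    joined u v Su Sv | inj₁ u∈ | inj₂ refl with attached Sv
    ...   | inj₁ Sc   = reachIn-mono v 1+K≤n
                          (reachIn-edge (k + ℓ) centre v (walk 0 u∈ centre-OnSpine Su Sc u∈reachIn0) Sv G-centre-pendant)
      where open Reachability G S u
            open Walk S convex u
    ...   | inj₂ only = ⊥-elim (pendant-¬OnSpine (subst OnSpine (only u Su) u∈))

  -- Splitting a convex set

  below : ℕ → V → Bool
  below c y = pos y <ᵇ c

  isPendant : V → Bool
  isPendant y = toℕ y ≡ᵇ 1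

  module _ {X : V → Bool} (X-convex : Convex X) where

    private
      convex : SpineConvex X
      convex = proj₁ X-convex

      attached : PendantAttached X
      attached = proj₂ X-convex

    Convex-below : ∀ c → Convex (λ y → X y ∧ below c y)
    Convex-below c = convex′ , attached′
      where
      convex′ : SpineConvex (λ y → X y ∧ below c y)
      convex′ u∈ x∈ w∈ Yu Yw ux xw with to T-∧ Yu | to T-∧ Yw
      ... | Xu , _ | Xw , w<c =
        from T-∧ (convex u∈ x∈ w∈ Xu Xw ux xw , <⇒<ᵇ {n = c} (≤-<-trans xw (<ᵇ⇒< _ c w<c)))
      attached′ : PendantAttached (λ y → X y ∧ below c y)
      attached′ Yp with to T-∧ Yp
      ... | Xp , p<c with attached Xp
      ...   | inj₁ Xc   = inj₁ (from T-∧ (Xc , subst (λ i → T (i <ᵇ c)) (trans pos-pendant (sym pos-centre)) p<c))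
      ...   | inj₂ only = inj₂ λ y Yy → only y (proj₁ (to T-∧ Yy))

    Convex-above : ∀ c → Convex (λ y → X y ∧ not (below c y))
    Convex-above c = convex′ , attached′
      where
      convex′ : SpineConvex (λ y → X y ∧ not (below c y))
      convex′ u∈ x∈ w∈ Yu Yw ux xw with to T-∧ Yu | to T-∧ Yw
      ... | Xu , u≮c | Xw , _ =
        from T-∧ (convex u∈ x∈ w∈ Xu Xw ux xw ,
                  ¬T⇒T-not λ x<c → T-not⇒¬T u≮c (<⇒<ᵇ {n = c} (≤-<-trans ux (<ᵇ⇒< _ c x<c))))
      attached′ : PendantAttached (λ y → X y ∧ not (below c y))
      attached′ Yp with to T-∧ Yp
      ... | Xp , p≮c with attached Xp
      ...   | inj₁ Xc   = inj₁ (from T-∧ (Xc , subst (λ i → T (not (i <ᵇ c))) (trans pos-pendant (sym pos-centre)) p≮c))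
      ...   | inj₂ only = inj₂ λ y Yy → only y (proj₁ (to T-∧ Yy))

    Convex-pendant : Convex (λ y → X y ∧ isPendant y)
    Convex-pendant = convex′ , λ _ → inj₂ λ y Yy → toℕ-injective (trans (≡ᵇ⇒≡ _ 1 (proj₂ (to T-∧ Yy))) (sym toℕ-pendant))
      where
      convex′ : SpineConvex (λ y → X y ∧ isPendant y)
      convex′ u∈ _ _ Yu = ⊥-elim (u∈ (≡ᵇ⇒≡ _ 1 (proj₂ (to T-∧ Yu))))

    Convex-spine : Convex (λ y → X y ∧ not (isPendant y))
    Convex-spine = convex′ , attached′
      where
      convex′ : SpineConvex (λ y → X y ∧ not (isPendant y))
      convex′ u∈ x∈ w∈ Yu Yw ux xw =
        from T-∧ (convex u∈ x∈ w∈ (proj₁ (to T-∧ Yu)) (proj₁ (to T-∧ Yw)) ux xw ,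
                  ¬T⇒T-not λ x≡1 → x∈ (≡ᵇ⇒≡ _ 1 x≡1))
      attached′ : PendantAttached (λ y → X y ∧ not (isPendant y))
      attached′ Yp = ⊥-elim (T-not⇒¬T (proj₂ (to T-∧ Yp)) (≡⇒≡ᵇ _ 1 toℕ-pendant))

  prefixCount : (V → Bool) → ℕ → ℕ
  prefixCount X c = count (λ y → X y ∧ below c y)

  layerCount : (V → Bool) → ℕ → ℕ
  layerCount X c = count (λ y → X y ∧ (pos y ≡ᵇ c))

  prefixCount-zero : ∀ (X : V → Bool) → prefixCount X 0 ≡ 0
  prefixCount-zero X = count≡0 (λ y → X y ∧ below 0 y) λ y Yy → proj₂ (to T-∧ Yy)

  prefixCount-all : ∀ (X : V → Bool) → prefixCount X (suc (k + ℓ)) ≡ count X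
  prefixCount-all X = count-cong λ y →
    trans (cong (X y ∧_) (to T-≡ (<⇒<ᵇ (s≤s (pos≤ y))))) (∧-identityʳ (X y))

  prefixCount-suc : ∀ (X : V → Bool) c → prefixCount X (suc c) ≡ prefixCount X c + layerCount X c
  prefixCount-suc X c = trans (count-split _ (below c)) (cong₂ _+_
    (count-cong λ y → trans (∧-assoc (X y) _ _) (cong (X y ∧_) (<ᵇ-suc-∧-<ᵇ (pos y) c)))
    (count-cong λ y → trans (∧-assoc (X y) _ _) (cong (X y ∧_) (<ᵇ-suc-∧-≮ᵇ (pos y) c))))

  layer-OnSpine : ∀ (X : V → Bool) c {y} → (c ≢ k ⊎ ¬ T (X pendant)) → T (X y ∧ (pos y ≡ᵇ c)) → OnSpine y
  layer-OnSpine X c {y} no-pendant Yy with OnSpine-or-pendant y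
  ... | inj₁ y∈   = y∈
  ... | inj₂ refl with to (T-∧ {X pendant}) Yy | no-pendant
  ...   | _  , pp≡c | inj₁ c≢k = ⊥-elim (c≢k (trans (sym (≡ᵇ⇒≡ _ c pp≡c)) pos-pendant))
  ...   | Xp , _    | inj₂ ¬Xp = ⊥-elim (¬Xp Xp)

  layerCount≤1 : ∀ (X : V → Bool) c → (c ≢ k ⊎ ¬ T (X pendant)) → layerCount X c ≤ 1
  layerCount≤1 X c no-pendant = count≤1 _ λ i j Yi Yj →
    pos-injective (layer-OnSpine X c no-pendant Yi) (layer-OnSpine X c no-pendant Yj)
      (trans (≡ᵇ⇒≡ _ c (proj₂ (to T-∧ Yi))) (sym (≡ᵇ⇒≡ _ c (proj₂ (to T-∧ Yj)))))

  layerCount≤2 : ∀ (X : V → Bool) c → layerCount X c ≤ 2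
  layerCount≤2 X c = subst (_≤ 2) (sym (count-split _ isPendant))
    (+-mono-≤ {_} {1} {_} {1}
      (count≤1 _ λ i j Yi Yj → trans (is-pendant Yi) (sym (is-pendant Yj)))
      (count≤1 _ λ i j Yi Yj → pos-injective (not-pendant Yi) (not-pendant Yj)
                                 (trans (layer Yi) (sym (layer Yj)))))
    where
    is-pendant : ∀ {y} → T ((X y ∧ (pos y ≡ᵇ c)) ∧ isPendant y) → y ≡ pendant
    is-pendant Yy = toℕ-injective (trans (≡ᵇ⇒≡ _ 1 (proj₂ (to T-∧ Yy))) (sym toℕ-pendant))
    not-pendant : ∀ {y} → T ((X y ∧ (pos y ≡ᵇ c)) ∧ not (isPendant y)) → OnSpine y
    not-pendant Yy y≡1 = T-not⇒¬T (proj₂ (to T-∧ Yy)) (≡⇒≡ᵇ _ 1 y≡1)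
    layer : ∀ {y} → T ((X y ∧ (pos y ≡ᵇ c)) ∧ not (isPendant y)) → pos y ≡ c
    layer {y} Yy = ≡ᵇ⇒≡ _ c (proj₂ (to (T-∧ {X y}) (proj₁ (to T-∧ Yy))))

  prefixCount-step≤1 : ∀ (X : V → Bool) c → (c ≢ k ⊎ ¬ T (X pendant)) →
    prefixCount X (suc c) ≤ 1 + prefixCount X c
  prefixCount-step≤1 X c no-pendant = begin
    prefixCount X (suc c)               ≡⟨ prefixCount-suc X c ⟩
    prefixCount X c + layerCount X c    ≤⟨ +-monoʳ-≤ _ (layerCount≤1 X c no-pendant) ⟩
    prefixCount X c + 1                 ≡⟨ +-comm _ 1 ⟩
    1 + prefixCount X c                 ∎
    where open ≤-Reasoning

  prefixCount-step≤2 : ∀ (X : V → Bool) c → prefixCount X (suc c) ≤ 2 + prefixCount X c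
  prefixCount-step≤2 X c = begin
    prefixCount X (suc c)               ≡⟨ prefixCount-suc X c ⟩
    prefixCount X c + layerCount X c    ≤⟨ +-monoʳ-≤ _ (layerCount≤2 X c) ⟩
    prefixCount X c + 2                 ≡⟨ +-comm _ 2 ⟩
    2 + prefixCount X c                 ∎
    where open ≤-Reasoning

  prefixCount-skip : ∀ (X : V → Bool) c → prefixCount X (suc c) ≡ 2 + prefixCount X c →
    c ≡ k × T (X pendant)
  prefixCount-skip X c skip = decide (c ≟ k) (T? (X pendant))
    where
    no-skip : ¬ (c ≢ k ⊎ ¬ T (X pendant))
    no-skip no-pendant = <⇒≱ (n<1+n (1 + prefixCount X c))
      (subst (_≤ 1 + prefixCount X c) skip (prefixCount-step≤1 X c no-pendant))
    decide : Dec (c ≡ k) → Dec (T (X pendant)) → c ≡ k × T (X pendant)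
    decide (yes c≡k) (yes Xp)  = c≡k , Xp
    decide (no  c≢k) _         = ⊥-elim (no-skip (inj₁ c≢k))
    decide (yes _)   (no  ¬Xp) = ⊥-elim (no-skip (inj₂ ¬Xp))

  ≤prefixCount-all : ∀ (X : V → Bool) {j} → j ≤ count X → j ≤ prefixCount X (suc (k + ℓ))
  ≤prefixCount-all X {j} = subst (j ≤_) (sym (prefixCount-all X))

  suffixCount≡ : ∀ (X : V → Bool) c {j} → j ≤ count X → prefixCount X c ≡ count X ∸ j →
    count (λ y → X y ∧ not (below c y)) ≡ j
  suffixCount≡ X c {j} j≤s fc≡s-j = begin
    count (λ y → X y ∧ not (below c y))                         ≡⟨ m+n∸m≡n (prefixCount X c) _ ⟨
    prefixCount X c + count (λ y → X y ∧ not (below c y)) ∸ prefixCount X c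
                                                                ≡⟨ cong (_∸ prefixCount X c) (count-split X (below c)) ⟨
    count X ∸ prefixCount X c                                   ≡⟨ cong (count X ∸_) fc≡s-j ⟩
    count X ∸ (count X ∸ j)                                     ≡⟨ m∸[m∸n]≡n j≤s ⟩
    j                                                           ∎
    where open ≡-Reasoning

  pendantCount≡1 : ∀ (X : V → Bool) → T (X pendant) → count (λ y → X y ∧ isPendant y) ≡ 1
  pendantCount≡1 X Xp = ≤-antisym
    (count≤1 _ λ y z Yy Yz → trans (is-pendant Yy) (sym (is-pendant Yz)))
    (1≤count _ pendant (from T-∧ (Xp , ≡⇒≡ᵇ _ 1 toℕ-pendant)))
    where
    is-pendant : ∀ {y} → T (X y ∧ isPendant y) → y ≡ pendant
    is-pendant {y} Yy = toℕ-injective (trans (≡ᵇ⇒≡ _ 1 (proj₂ (to (T-∧ {X y}) Yy))) (sym toℕ-pendant))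

  convex-split : ∀ {X} → Convex X → ∀ {j} → 1 ≤ j → j ≤ count X → (count X ≡ j + j → j ≡ 1) →
    Σ (V → Bool) λ Z → Convex (λ y → X y ∧ Z y) × Convex (λ y → X y ∧ not (Z y)) ×
                       count (λ y → X y ∧ Z y) ≡ j
  convex-split {X} X-convex {j} 1≤j j≤s halves⇒1
    with hits-or-skips (prefixCount X) (prefixCount-zero X) (prefixCount-step≤2 X) (suc (k + ℓ)) (≤prefixCount-all X j≤s)
  ... | inj₁ (c , fc≡j) = below c , Convex-below X-convex c , Convex-above X-convex c , fc≡j
  ... | inj₂ (c , 1+fc≡j , f1+c≡1+j) with prefixCount-skip X c (trans f1+c≡1+j (cong suc (sym 1+fc≡j)))
  ...   | c≡k , Xp with hits-or-skips (prefixCount X) (prefixCount-zero X) (prefixCount-step≤2 X) (suc (k + ℓ))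
                          (≤prefixCount-all X (m∸n≤m (count X) j))
  ...     | inj₁ (c′ , fc′≡s-j) =
    (λ y → not (below c′ y)) , Convex-above X-convex c′ ,
    Convex-cong (λ y → cong (X y ∧_) (sym (not-involutive (below c′ y)))) (Convex-below X-convex c′) ,
    suffixCount≡ X c′ j≤s fc′≡s-j
  ...     | inj₂ (c′ , 1+fc′≡s-j , f1+c′≡1+s-j) with prefixCount-skip X c′ (trans f1+c′≡1+s-j (cong suc (sym 1+fc′≡s-j)))
  ...       | c′≡k , _ = isPendant , Convex-pendant X-convex , Convex-spine X-convex , trans (pendantCount≡1 X Xp) (sym j≡1)
    where
    -- Prefix and suffix both jump at the centre, over j and over count X ∸ j respectively.
    s-j≡j : count X ∸ j ≡ j
    s-j≡j = trans (sym 1+fc′≡s-j) (trans (cong (suc ∘ prefixCount X) (trans c′≡k (sym c≡k))) 1+fc≡j)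
    j≡1 : j ≡ 1
    j≡1 = halves⇒1 (trans (sym (m∸n+n≡m j≤s)) (cong (_+ j) s-j≡j))

  legalMove-of-size : ∀ N (P : Subset (k + ℓ + 2)) → T (connected G P) →
    ∀ {j} → 1 ≤ j → j ≤ N → j ≤ ∣ P ∣ → (∣ P ∣ ≡ j + j → j ≡ 1) →
    Σ (Subset (k + ℓ + 2)) λ M → T (legalMove G (I N) P M) × ∣ M ∣ ≡ j
  legalMove-of-size N P conn {j} 1≤j j≤N j≤∣P∣ halves⇒1
    with convex-split (connected⇒Convex P conn) 1≤j (subst (j ≤_) (∣∣≡count P) j≤∣P∣)
                      (halves⇒1 ∘ trans (∣∣≡count P))
  ... | Z , convex-in , convex-out , ∣M∣≡j = M , legal , ∣M∣≡j
    where
    M : Subset (k + ℓ + 2)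
    M = tabulate (λ y → lookup P y ∧ Z y)

    lookup-M : ∀ y → (lookup P y ∧ Z y) ≡ lookup M y
    lookup-M y = sym (lookup∘tabulate _ y)

    lookup-rest : ∀ y → (lookup P y ∧ not (Z y)) ≡ lookup (P ∩ ∁ M) y
    lookup-rest y = sym (trans (lookup-∩∁ P M y) (trans (cong (λ b → lookup P y ∧ not b) (sym (lookup-M y)))
                          (absorb (lookup P y))))
      where
      absorb : ∀ b → (b ∧ not (b ∧ Z y)) ≡ (b ∧ not (Z y))
      absorb true  = refl
      absorb false = refl

    M⊆P : T (M ⊆ᵇ P)
    M⊆P = T-allF⁺ λ y → subst (λ b → T (not b ∨ lookup P y)) (lookup-M y) (not-∧-∨ (lookup P y) (Z y))
      where
      not-∧-∨ : ∀ b z → T (not (b ∧ z) ∨ b)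
      not-∧-∨ true  true  = tt
      not-∧-∨ true  false = tt
      not-∧-∨ false _     = tt

    legal : T (legalMove G (I N) P M)
    legal = from T-∧ (M⊆P , from T-∧ (1≤ᵇ∣M∣ , from T-∧ (from T-∧ (1≤ᵇ∣M∣ , ≤⇒≤ᵇ (subst (_≤ N) (sym ∣M∣≡j) j≤N)) ,
              from T-∧ (Convex⇒connected M (Convex-cong lookup-M convex-in) ,
                        Convex⇒connected (P ∩ ∁ M) (Convex-cong lookup-rest convex-out)))))
      where
      1≤ᵇ∣M∣ : T (1 ≤ᵇ ∣ M ∣)
      1≤ᵇ∣M∣ = ≤⇒≤ᵇ (subst (1 ≤_) (sym ∣M∣≡j) 1≤j)

  -- Grundy values

  module GrundyStep (N : ℕ) (g : Subset (k + ℓ + 2) → ℕ) (P : Subset (k + ℓ + 2)) (P-connected : T (connected G P))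
    (ih : ∀ Q → T (connected G Q) → ∣ Q ∣ < ∣ P ∣ → cap (g Q) ≡ cap (∣ Q ∣ % suc N)) where

    values : List ℕ
    values = map g (options G (I N) P)

    option-cap : ∀ M → T (legalMove G (I N) P M) → cap (g (P ∩ ∁ M)) ≡ cap (∣ P ∩ ∁ M ∣ % suc N)
    option-cap M legal with legalMove-I⁻ G N P M legal
    ... | M⊆P , 1≤∣M∣ , _ , rest-connected =
      ih (P ∩ ∁ M) rest-connected (subst (∣ P ∩ ∁ M ∣ <_) (∣P∩∁M∣+∣M∣≡∣P∣ P M M⊆P) (m<m+n _ 1≤∣M∣))

    residue-changes : ∀ M → T (legalMove G (I N) P M) → ∣ P ∩ ∁ M ∣ % suc N ≢ ∣ P ∣ % suc N
    residue-changes M legal same with legalMove-I⁻ G N P M legal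
    ... | M⊆P , 1≤∣M∣ , ∣M∣≤N , _ =
      [m+n]%o≢m%o ∣ P ∩ ∁ M ∣ 1≤∣M∣ (s≤s ∣M∣≤N) (trans (%-congˡ (∣P∩∁M∣+∣M∣≡∣P∣ P M M⊆P)) (sym same))

    residue∉values : ∣ P ∣ % suc N ≤ 1 → ∣ P ∣ % suc N ∉ values
    residue∉values r≤1 r∈values with ∈-map⁻ g r∈values
    ... | Q , Q∈options , r≡gQ with ∈-options⁻ G (I N) P Q∈options
    ...   | M , legal , refl =
      residue-changes M legal (cap≡cap⇒≡ r≤1 (trans (sym (option-cap M legal)) (cong cap (sym r≡gQ))))

    ∈values : ∀ {j v} → 1 ≤ j → j ≤ N → j ≤ ∣ P ∣ → (∣ P ∣ ≡ j + j → j ≡ 1) →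
      v ≤ 1 → (∣ P ∣ ∸ j) % suc N ≡ v → v ∈ values
    ∈values {j} {v} 1≤j j≤N j≤∣P∣ halves⇒1 v≤1 residue
      with legalMove-of-size N P P-connected 1≤j j≤N j≤∣P∣ halves⇒1
    ... | M , legal , ∣M∣≡j = subst (_∈ values) gQ≡v (∈-map⁺ g (∈-options⁺ G (I N) P legal))
      where
      ∣P∩∁M∣≡∣P∣∸j : ∣ P ∩ ∁ M ∣ ≡ ∣ P ∣ ∸ j
      ∣P∩∁M∣≡∣P∣∸j = trans (sym (m+n∸n≡m _ ∣ M ∣))
        (cong₂ _∸_ (∣P∩∁M∣+∣M∣≡∣P∣ P M (proj₁ (legalMove-I⁻ G N P M legal))) ∣M∣≡j)
      gQ≡v : g (P ∩ ∁ M) ≡ v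
      gQ≡v = cap≡cap⇒≡ v≤1 (trans (option-cap M legal) (cong cap (trans (%-congˡ ∣P∩∁M∣≡∣P∣∸j) residue)))

    cap-mex-by-residue : ∀ r → ∣ P ∣ % suc N ≡ r → cap (mex values) ≡ cap r
    cap-mex-by-residue zero r≡0 =
      cong cap (mex≡0 values (subst (_∉ values) r≡0 (residue∉values (subst (_≤ 1) (sym r≡0) z≤n))))
    cap-mex-by-residue (suc zero) r≡1 = cong cap (mex≡1 values 0∈values 1∉values)
      where
      0∈values : 0 ∈ values
      0∈values = ∈values ≤-refl (≤-pred (subst (_< suc N) r≡1 (m%n<n ∣ P ∣ (suc N))))
                   (subst (_≤ ∣ P ∣) r≡1 (m%n≤m ∣ P ∣ (suc N))) (λ _ → refl) z≤n
                   (subst (λ r → (∣ P ∣ ∸ r) % suc N ≡ 0) r≡1 ([m∸m%n]%n≡0 ∣ P ∣ (suc N)))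
      1∉values : 1 ∉ values
      1∉values = subst (_∉ values) r≡1 (residue∉values (subst (_≤ 1) (sym r≡1) ≤-refl))
    cap-mex-by-residue (suc (suc r)) r≡2+r = 2≤⇒cap≡2 (2≤mex values 0∈values 1∈values)
      where
      2+r<1+N : 2 + r < suc N
      2+r<1+N = subst (_< suc N) r≡2+r (m%n<n ∣ P ∣ (suc N))
      2+r≤∣P∣ : 2 + r ≤ ∣ P ∣
      2+r≤∣P∣ = subst (_≤ ∣ P ∣) r≡2+r (m%n≤m ∣ P ∣ (suc N))
      0∈values : 0 ∈ values
      0∈values = ∈values (s≤s z≤n) (≤-pred 2+r<1+N) 2+r≤∣P∣
                   (λ ∣P∣≡2[2+r] → ⊥-elim ([m+m]%n≢m z<s 2+r<1+N (trans (%-congˡ (sym ∣P∣≡2[2+r])) r≡2+r)))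
                   z≤n (subst (λ r → (∣ P ∣ ∸ r) % suc N ≡ 0) r≡2+r ([m∸m%n]%n≡0 ∣ P ∣ (suc N)))
      1∈values : 1 ∈ values
      1∈values = ∈values (s≤s z≤n) (≤-pred (<-trans (n<1+n _) 2+r<1+N)) (≤-trans (n≤1+n _) 2+r≤∣P∣)
                   (λ ∣P∣≡2[1+r] → [m+m]%n≡1+m⇒m≡1 {n = suc N} (trans (%-congˡ (sym ∣P∣≡2[1+r])) r≡2+r))
                   ≤-refl (m%n≡1+r⇒[m∸r]%n≡1 ∣ P ∣ (suc N) r≡2+r)

    cap-mex : cap (mex values) ≡ cap (∣ P ∣ % suc N)
    cap-mex = cap-mex-by-residue (∣ P ∣ % suc N) refl

  cap-grundyF : ∀ N f (P : Subset (k + ℓ + 2)) → T (connected G P) → ∣ P ∣ ≤ f →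
    cap (grundyF G (I N) f P) ≡ cap (∣ P ∣ % suc N)
  cap-grundyF N zero    P _           ∣P∣≤0   rewrite n≤0⇒n≡0 ∣P∣≤0 = refl
  cap-grundyF N (suc f) P P-connected ∣P∣≤1+f =
    GrundyStep.cap-mex N (grundyF G (I N) f) P P-connected λ Q Q-connected ∣Q∣<∣P∣ →
      cap-grundyF N f Q Q-connected (≤-pred (≤-trans ∣Q∣<∣P∣ ∣P∣≤1+f))

  cap-grundy : ∀ N → cap (grundy (I N) G) ≡ cap ((k + ℓ + 2) % suc N)
  cap-grundy N = subst (λ m → cap (grundy (I N) G) ≡ cap (m % suc N)) (∣⊤∣≡n (k + ℓ + 2))
    (cap-grundyF N (k + ℓ + 2) ⊤ connected-⊤ (≤-reflexive (∣⊤∣≡n (k + ℓ + 2))))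
    where
    connected-⊤ : T (connected G ⊤)
    connected-⊤ = Convex⇒connected ⊤
      (Convex-cong (λ y → sym (lookup-replicate y true)) ((λ _ _ _ _ _ _ _ → tt) , λ _ → inj₁ tt))

lemma13 : (N k ℓ : ℕ) → 3 ≤ N →
    (((k + ℓ + 2) % suc N ≡ 0 → grundy (I N) (S1 k ℓ) ≡ 0)
    × ((k + ℓ + 2) % suc N ≡ 1 → grundy (I N) (S1 k ℓ) ≡ 1)
    × ((k + ℓ + 2) % suc N ≢ 0 → (k + ℓ + 2) % suc N ≢ 1 → 1 < grundy (I N) (S1 k ℓ)))
lemma13 N k ℓ _ =
    (λ r≡0 → cap≡cap⇒≡ z≤n (trans cap-grundy′ (cong cap r≡0)))
  , (λ r≡1 → cap≡cap⇒≡ ≤-refl (trans cap-grundy′ (cong cap r≡1)))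
  , (λ r≢0 r≢1 → cap≡2⇒2≤ (trans cap-grundy′ (cap≡2 r≢0 r≢1)))
  where
  cap-grundy′ : cap (grundy (I N) (S1 k ℓ)) ≡ cap ((k + ℓ + 2) % suc N)
  cap-grundy′ = Star.cap-grundy k ℓ N
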